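{- Let $P$ be a binary matrix with rows $\mathbf{p}\in\mathbb{F}_2^n$, let $\mathbf{H}_P=\sum_{\mathbf{p}}\frac{\pi}{8}\prod_{j:p_j=1}X_j$, let $\mathbf{X}$ satisfy $\Pr(\mathbf{X}=\mathbf{x})=|\langle\mathbf{x}|\exp(i\mathbf{H}_P)|\mathbf{0}\rangle|^2$, and let $\mathbf{Y}$ satisfy $\Pr(\mathbf{Y}=\mathbf{y})=\Pr_{\mathbf{d},\mathbf{e}}\bigl(\sum_{\mathbf{p}\in P_{\mathbf{d}}\cap P_{\mathbf{e}}}\mathbf{p}=\mathbf{y}\bigr)$ with $\mathbf{d},\mathbf{e}$ uniform and independent on $\mathbb{F}_2^n$, where $P_{\mathbf{d}}$ is the set of rows with $\mathbf{p}\cdot\mathbf{d}^T=1$. Then for every $\mathbf{s}\in\mathbb{F}_2^n$, $\Pr(\mathbf{X}\cdot\mathbf{s}^T=0)=1$ implies $\Pr(\mathbf{Y}\cdot\mathbf{s}^T=0)=1$.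
   Context: $X_j$ is Pauli $X$ on qubit $j$ of $n$ qubits; inner products are over $\mathbb{F}_2$. -}

module Defs where

open import Data.Bool using (Bool; true; false; _xor_; _∧_; if_then_else_)
open import Data.Nat using (ℕ)
open import Data.Integer using (ℤ; +_; -_) renaming (_+_ to _+ℤ_; _*_ to _*ℤ_)
open import Data.Vec using (Vec; []; _∷_; zipWith; foldr; replicate; map)
open import Data.List using (List) renaming (foldr to lfoldr; filter to lfilter)
open import Relation.Nullary.Decidable using (yes; no)
open import Data.Bool using (_≟_)

𝔽₂^ : ℕ → Set
𝔽₂^ n = Vec Bool n

_⊕_ : ∀ {n} → 𝔽₂^ n → 𝔽₂^ n → 𝔽₂^ n
_⊕_ = zipWith _xor_

𝟎 : ∀ {n} → 𝔽₂^ n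
𝟎 {n} = replicate n false

_·_ : ∀ {n} → 𝔽₂^ n → 𝔽₂^ n → Bool
x · y = foldr _ _xor_ false (zipWith _∧_ x y)

vsum : ∀ {n} → List (𝔽₂^ n) → 𝔽₂^ n
vsum = lfoldr _⊕_ 𝟎

-- Exact arithmetic in the cyclotomic ring ℤ[ζ], ζ = exp(iπ/8),
-- minimal polynomial x⁸ + 1; elements are coefficient vectors in the
-- basis 1, ζ, …, ζ⁷ (so equality is coordinatewise).

Zζ : Set
Zζ = Vec ℤ 8

0ζ : Zζ
0ζ = replicate 8 (+ 0)

1ζ : Zζ
1ζ = + 1 ∷ + 0 ∷ + 0 ∷ + 0 ∷ + 0 ∷ + 0 ∷ + 0 ∷ + 0 ∷ []

_+ζ_ : Zζ → Zζ → Zζ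
_+ζ_ = zipWith _+ℤ_

scaleζ : ℤ → Zζ → Zζ
scaleζ k = map (k *ℤ_)

mulζ : Zζ → Zζ
mulζ (a0 ∷ a1 ∷ a2 ∷ a3 ∷ a4 ∷ a5 ∷ a6 ∷ a7 ∷ []) =
  (- a7) ∷ a0 ∷ a1 ∷ a2 ∷ a3 ∷ a4 ∷ a5 ∷ a6 ∷ []

private
  mulAux : ∀ {k} → Vec ℤ k → Zζ → Zζ
  mulAux [] b = 0ζ
  mulAux (a ∷ as) b = scaleζ a b +ζ mulAux as (mulζ b)

_*ζ_ : Zζ → Zζ → Zζ
a *ζ b = mulAux a b

-- 2·cos(π/8) = ζ + ζ⁻¹ = ζ - ζ⁷
twoCos : Zζ
twoCos = + 0 ∷ + 1 ∷ + 0 ∷ + 0 ∷ + 0 ∷ + 0 ∷ + 0 ∷ -[1] ∷ []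
  where -[1] = - (+ 1)

-- 2·i·sin(π/8) = ζ - ζ⁻¹ = ζ + ζ⁷
twoISin : Zζ
twoISin = + 0 ∷ + 1 ∷ + 0 ∷ + 0 ∷ + 0 ∷ + 0 ∷ + 0 ∷ + 1 ∷ []

State : ℕ → Set
State n = 𝔽₂^ n → Zζ

ket0 : ∀ {n} → State n
ket0 x = if x =?𝟎 then 1ζ else 0ζ
  where
  _=?𝟎 : ∀ {m} → 𝔽₂^ m → Bool
  [] =?𝟎 = true
  (b ∷ bs) =?𝟎 = if b then false else (bs =?𝟎)

-- 2·exp(i (π/8) X^p) = 2cos(π/8) I + 2 i sin(π/8) X^p, where
-- X^p = ∏_{j : p_j = 1} X_j acts as |y⟩ ↦ |y ⊕ p⟩.
gate2 : ∀ {n} → 𝔽₂^ n → State n → State n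
gate2 p ψ x = (twoCos *ζ ψ x) +ζ (twoISin *ζ ψ (x ⊕ p))

-- All terms of H_P commute, so exp(i H_P) = ∏_p exp(i (π/8) X^p).
-- ampl2 P x = 2^{|P|} · ⟨x| exp(i H_P) |0⟩  (exactly, in ℤ[ζ]).
ampl2 : ∀ {n} → List (𝔽₂^ n) → State n
ampl2 P = lfoldr gate2 ket0 P

-- Pr(X · sᵀ = 0) = 1 : every outcome x with x·sᵀ = 1 has probability
-- |⟨x|exp(iH_P)|0⟩|² = 0, i.e. amplitude 0.
ProbXsZeroIsOne : ∀ {n} → List (𝔽₂^ n) → 𝔽₂^ n → Set
ProbXsZeroIsOne P s = ∀ x → x · s ≡ true → ampl2 P x ≡ 0ζ
  where open import Relation.Binary.PropositionalEquality using (_≡_)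

Pde : ∀ {n} → List (𝔽₂^ n) → 𝔽₂^ n → 𝔽₂^ n → List (𝔽₂^ n)
Pde P d e = lfilter (λ p → (p · d ∧ p · e) ≟ true) P

-- Pr(Y · sᵀ = 0) = 1 with d,e uniform on 𝔽₂ⁿ (full support, finite):
-- for all d, e the sum over P_d ∩ P_e is orthogonal to s.
ProbYsZeroIsOne : ∀ {n} → List (𝔽₂^ n) → 𝔽₂^ n → Set
ProbYsZeroIsOne P s = ∀ d e → vsum (Pde P d e) · s ≡ false
  where open import Relation.Binary.PropositionalEquality using (_≡_)

-- Each factor exp(i (π/8) X^p) is diagonal in the X basis, so under the Walsh–Hadamard
-- transform W the amplitude vector becomes W(y) = 2^|P| ζ^(∑_p ±1), the sign being (−1)^(p·y)
-- and ζ = exp(iπ/8). If all outcomes x with x·s = 1 have amplitude 0, multiplying the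
-- amplitude by (−1)^(x·s) changes nothing, i.e. W(y ⊕ s) = W(y). Comparing exponents mod 16
-- gives 16 ∣ 14 S(y), hence 8 ∣ S(y), for S(y) = ∑_{p·s=1} (−1)^(p·y). Finally
-- S(0) + S(d ⊕ e) − S(d) − S(e) = 4 #{p : p·d = p·e = p·s = 1}, so this number is even; but
-- its parity is (∑_{p ∈ P_d ∩ P_e} p)·s.

module Submission where

open import Defs
open import Algebra.Bundles using (AbelianGroup)
open import Algebra.Structures using (IsAbelianGroup)
import Algebra.Properties.AbelianGroup as AbelianGroupProperties
import Algebra.Properties.CommutativeSemigroup as CommutativeSemigroupProperties
import Algebra.Properties.Group as GroupProperties
open import Data.Bool using (Bool; true; false; _xor_; _∧_; if_then_else_)
import Data.Bool as Bool
open import Data.Bool.Properties using (xor-∧-commutativeRing; ∧-distribˡ-xor; ∧-distribʳ-xor)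
open import Data.Integer using (ℤ; +_; -_) renaming (_+_ to _+ℤ_; _-_ to _-ℤ_; _*_ to _*ℤ_)
open import Data.Integer.Divisibility.Signed
  using (_∣_; divides; ∣⇒∣ᵤ; ∣-refl; ∣m⇒∣m*n; ∣m∣n⇒∣m+n; ∣m∣n⇒∣m-n; ∣m+n∣m⇒∣n; *-cancelˡ-∣)
open import Data.Integer.Tactic.RingSolver using (solve-∀)
import Data.Integer.Properties as ℤ
open import Data.Nat using (ℕ; zero; suc; _+_; _*_; _^_; _%_; _/_; _<_; NonZero)
import Data.Nat.Properties as ℕ
open import Data.Nat.Properties using (allUpTo?)
open import Data.Nat.DivMod using (m≡m%n+[m/n]*n; m%n<n)
open import Data.Nat.Divisibility using (∣1⇒≡1)
open import Data.Nat.ListAction using (sum)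
open import Data.List using (List; []; _∷_)
import Data.List as L
open import Function using (_∘_)
open import Data.Product using (_,_)
open import Data.Vec using (Vec; []; _∷_; map; zipWith; replicate; _++_)
open import Data.Vec.Properties
  using (zipWith-assoc; zipWith-comm; zipWith-identityˡ; zipWith-identityʳ;
         zipWith-inverseˡ; zipWith-inverseʳ; ∷-injectiveˡ; ∷-injectiveʳ; ≡-dec; map-∘; map-cong; map-const)
open import Level using (0ℓ)
open import Relation.Binary.PropositionalEquality
open import Relation.Nullary using (does; ¬_; contradiction)
open import Relation.Nullary.Decidable using (toWitness)
open import Relation.Binary.PropositionalEquality.Algebra using (isMagma)

open CommutativeSemigroupProperties
  (Algebra.Bundles.CommutativeRing.+-commutativeSemigroup xor-∧-commutativeRing)
  using () renaming (interchange to xor-interchange)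
open CommutativeSemigroupProperties ℤ.+-commutativeSemigroup
  using () renaming (interchange to +ℤ-interchange)
open AbelianGroupProperties ℤ.+-0-abelianGroup using (xyx⁻¹≈y)

·-distribˡ-⊕ : ∀ {n} (p y s : 𝔽₂^ n) → p · (y ⊕ s) ≡ (p · y) xor (p · s)
·-distribˡ-⊕ [] [] [] = refl
·-distribˡ-⊕ (a ∷ p) (b ∷ y) (c ∷ s) =
  trans (cong₂ _xor_ (∧-distribˡ-xor a b c) (·-distribˡ-⊕ p y s))
        (xor-interchange (a ∧ b) (a ∧ c) (p · y) (p · s))

·-distribʳ-⊕ : ∀ {n} (p q s : 𝔽₂^ n) → (p ⊕ q) · s ≡ (p · s) xor (q · s)
·-distribʳ-⊕ [] [] [] = refl
·-distribʳ-⊕ (a ∷ p) (b ∷ q) (c ∷ s) =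
  trans (cong₂ _xor_ (∧-distribʳ-xor c a b) (·-distribʳ-⊕ p q s))
        (xor-interchange (a ∧ c) (b ∧ c) (p · s) (q · s))

·-zeroʳ : ∀ {n} (p : 𝔽₂^ n) → p · 𝟎 ≡ false
·-zeroʳ [] = refl
·-zeroʳ (a ∷ p) = cong₂ _xor_ (Data.Bool.Properties.∧-zeroʳ a) (·-zeroʳ p)

·-zeroˡ : ∀ {n} (s : 𝔽₂^ n) → 𝟎 · s ≡ false
·-zeroˡ [] = refl
·-zeroˡ (c ∷ s) = ·-zeroˡ s

-- Arithmetic in ℤ[ζ]

negζ : Zζ → Zζ
negζ = map -_

+ζ-isAbelianGroup : IsAbelianGroup _≡_ _+ζ_ 0ζ negζ
+ζ-isAbelianGroup = record
  { isGroup = record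
    { isMonoid = record
      { isSemigroup = record
        { isMagma = isMagma _+ζ_
        ; assoc = zipWith-assoc ℤ.+-assoc }
      ; identity = zipWith-identityˡ ℤ.+-identityˡ , zipWith-identityʳ ℤ.+-identityʳ }
    ; inverse = zipWith-inverseˡ ℤ.+-inverseˡ , zipWith-inverseʳ ℤ.+-inverseʳ
    ; ⁻¹-cong = cong negζ }
  ; comm = zipWith-comm ℤ.+-comm }

+ζ-abelianGroup : AbelianGroup 0ℓ 0ℓ
+ζ-abelianGroup = record { isAbelianGroup = +ζ-isAbelianGroup }

open AbelianGroup +ζ-abelianGroup using () renaming (comm to +ζ-comm; inverseˡ to +ζ-inverseˡ; identityˡ to +ζ-identityˡ; identityʳ to +ζ-identityʳ)
open AbelianGroupProperties +ζ-abelianGroup using (⁻¹-∙-comm; ⁻¹-anti-homo‿-)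
open GroupProperties (AbelianGroup.group +ζ-abelianGroup) using (⁻¹-involutive; identityʳ-unique; inverseˡ-unique)
open CommutativeSemigroupProperties (AbelianGroup.commutativeSemigroup +ζ-abelianGroup)
  using () renaming (interchange to +ζ-interchange)

map-homo₂ : ∀ {k} {f : ℤ → ℤ} → (∀ x y → f (x +ℤ y) ≡ f x +ℤ f y) →
            ∀ (u v : Vec ℤ k) → map f (zipWith _+ℤ_ u v) ≡ zipWith _+ℤ_ (map f u) (map f v)
map-homo₂ homo [] [] = refl
map-homo₂ homo (x ∷ u) (y ∷ v) = cong₂ _∷_ (homo x y) (map-homo₂ homo u v)

map-injective : ∀ {k} {f : ℤ → ℤ} → (∀ {x y} → f x ≡ f y → x ≡ y) →
                ∀ (u v : Vec ℤ k) → map f u ≡ map f v → u ≡ v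
map-injective f-inj [] [] eq = refl
map-injective f-inj (x ∷ u) (y ∷ v) eq =
  cong₂ _∷_ (f-inj (∷-injectiveˡ eq)) (map-injective f-inj u v (∷-injectiveʳ eq))

Additive : (Zζ → Zζ) → Set
Additive f = ∀ u v → f (u +ζ v) ≡ f u +ζ f v

module _ {f : Zζ → Zζ} (f-additive : Additive f) where

  Additive⇒0 : f 0ζ ≡ 0ζ
  Additive⇒0 = identityʳ-unique (f 0ζ) (f 0ζ) (sym (f-additive 0ζ 0ζ))

  Additive⇒negζ : ∀ u → f (negζ u) ≡ negζ (f u)
  Additive⇒negζ u = inverseˡ-unique (f (negζ u)) (f u) (begin
    f (negζ u) +ζ f u  ≡⟨ f-additive (negζ u) u ⟨
    f (negζ u +ζ u)    ≡⟨ cong f (+ζ-inverseˡ u) ⟩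
    f 0ζ               ≡⟨ Additive⇒0 ⟩
    0ζ                 ∎)
    where open ≡-Reasoning

negζ-additive : Additive negζ
negζ-additive u v = sym (⁻¹-∙-comm u v)

scaleζ-additive : ∀ c → Additive (scaleζ c)
scaleζ-additive c = map-homo₂ (ℤ.*-distribˡ-+ c)

mulζ-additive : Additive mulζ
mulζ-additive (a0 ∷ a1 ∷ a2 ∷ a3 ∷ a4 ∷ a5 ∷ a6 ∷ a7 ∷ []) (b0 ∷ b1 ∷ b2 ∷ b3 ∷ b4 ∷ b5 ∷ b6 ∷ b7 ∷ []) =
  cong (_∷ _) (ℤ.neg-distrib-+ a7 b7)

negateIf : Bool → Zζ → Zζ
negateIf false v = v
negateIf true v = negζ v

negateIf-additive : ∀ b → Additive (negateIf b)
negateIf-additive false u v = refl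
negateIf-additive true = negζ-additive

negateIf-xor : ∀ a b v → negateIf (a xor b) v ≡ negateIf a (negateIf b v)
negateIf-xor false b v = refl
negateIf-xor true false v = refl
negateIf-xor true true v = sym (⁻¹-involutive v)

Additive⇒negateIf : ∀ {f} → Additive f → ∀ b u → f (negateIf b u) ≡ negateIf b (f u)
Additive⇒negateIf f-additive false u = refl
Additive⇒negateIf f-additive true u = Additive⇒negζ f-additive u

ζ^[_] : ℕ → Zζ → Zζ
ζ^[ zero ] v = v
ζ^[ suc j ] v = mulζ (ζ^[ j ] v)

ζ^[]-mulζ : ∀ j v → ζ^[ j ] (mulζ v) ≡ ζ^[ suc j ] v
ζ^[]-mulζ zero v = refl
ζ^[]-mulζ (suc j) v = cong mulζ (ζ^[]-mulζ j v)

ζ^[]-+ : ∀ a b v → ζ^[ a ] (ζ^[ b ] v) ≡ ζ^[ a + b ] v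
ζ^[]-+ zero b v = refl
ζ^[]-+ (suc a) b v = cong mulζ (ζ^[]-+ a b v)

ζ^[8]≡negζ : ∀ v → ζ^[ 8 ] v ≡ negζ v
ζ^[8]≡negζ (a0 ∷ a1 ∷ a2 ∷ a3 ∷ a4 ∷ a5 ∷ a6 ∷ a7 ∷ []) = refl

ζ^[16]≡id : ∀ v → ζ^[ 16 ] v ≡ v
ζ^[16]≡id v = begin
  ζ^[ 8 ] (ζ^[ 8 ] v) ≡⟨ cong ζ^[ 8 ] (ζ^[8]≡negζ v) ⟩
  ζ^[ 8 ] (negζ v)    ≡⟨ ζ^[8]≡negζ (negζ v) ⟩
  negζ (negζ v)       ≡⟨ ⁻¹-involutive v ⟩
  v                   ∎
  where open ≡-Reasoning

mulζ-scaleζ : ∀ c v → mulζ (scaleζ c v) ≡ scaleζ c (mulζ v)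
mulζ-scaleζ c (a0 ∷ a1 ∷ a2 ∷ a3 ∷ a4 ∷ a5 ∷ a6 ∷ a7 ∷ []) = cong (_∷ _) (ℤ.neg-distribʳ-* c a7)

ζ^[]-scaleζ : ∀ j c v → ζ^[ j ] (scaleζ c v) ≡ scaleζ c (ζ^[ j ] v)
ζ^[]-scaleζ zero c v = refl
ζ^[]-scaleζ (suc j) c v = trans (cong mulζ (ζ^[]-scaleζ j c v)) (mulζ-scaleζ c _)

map-*-distribʳ-+ : ∀ {k} a c (v : Vec ℤ k) →
                  map ((a +ℤ c) *ℤ_) v ≡ zipWith _+ℤ_ (map (a *ℤ_) v) (map (c *ℤ_) v)
map-*-distribʳ-+ a c [] = refl
map-*-distribʳ-+ a c (x ∷ v) = cong₂ _∷_ (ℤ.*-distribʳ-+ x a c) (map-*-distribʳ-+ a c v)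

scaleζ-zeroˡ : ∀ v → scaleζ (+ 0) v ≡ 0ζ
scaleζ-zeroˡ v = trans (map-cong ℤ.*-zeroˡ v) (map-const v (+ 0))

scaleζ-assoc : ∀ c d v → scaleζ c (scaleζ d v) ≡ scaleζ (c *ℤ d) v
scaleζ-assoc c d v = trans (sym (map-∘ (c *ℤ_) (d *ℤ_) v)) (map-cong (λ x → sym (ℤ.*-assoc c d x)) v)

scaleζ-neg : ∀ c v → scaleζ (- c) v ≡ negζ (scaleζ c v)
scaleζ-neg c v = trans (map-cong (λ x → sym (ℤ.neg-distribˡ-* c x)) v) (map-∘ -_ (c *ℤ_) v)

scaleζ-injective : ∀ m .{{_ : NonZero m}} u v → scaleζ (+ m) u ≡ scaleζ (+ m) v → u ≡ v
scaleζ-injective m = map-injective (ℤ.*-cancelˡ-≡ (+ m) _ _)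

-- The recursion behind _*ζ_ (private in Defs), for coefficient vectors of any length.
_⊛_ : ∀ {k} → Vec ℤ k → Zζ → Zζ
[] ⊛ v = 0ζ
(a ∷ as) ⊛ v = scaleζ a v +ζ (as ⊛ mulζ v)

⊛-additiveʳ : ∀ {k} (as : Vec ℤ k) → Additive (as ⊛_)
⊛-additiveʳ [] u v = refl
⊛-additiveʳ (a ∷ as) u v = begin
  scaleζ a (u +ζ v) +ζ (as ⊛ mulζ (u +ζ v))
    ≡⟨ cong₂ _+ζ_ (scaleζ-additive a u v)
                  (trans (cong (as ⊛_) (mulζ-additive u v)) (⊛-additiveʳ as _ _)) ⟩
  (scaleζ a u +ζ scaleζ a v) +ζ ((as ⊛ mulζ u) +ζ (as ⊛ mulζ v))
    ≡⟨ +ζ-interchange _ _ _ _ ⟩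
  (scaleζ a u +ζ (as ⊛ mulζ u)) +ζ (scaleζ a v +ζ (as ⊛ mulζ v))
    ∎
  where open ≡-Reasoning

⊛-distribʳ : ∀ {k} (as cs : Vec ℤ k) v → zipWith _+ℤ_ as cs ⊛ v ≡ (as ⊛ v) +ζ (cs ⊛ v)
⊛-distribʳ [] [] v = refl
⊛-distribʳ (a ∷ as) (c ∷ cs) v = begin
  scaleζ (a +ℤ c) v +ζ (zipWith _+ℤ_ as cs ⊛ mulζ v)
    ≡⟨ cong₂ _+ζ_ (map-*-distribʳ-+ a c v) (⊛-distribʳ as cs (mulζ v)) ⟩
  (scaleζ a v +ζ scaleζ c v) +ζ ((as ⊛ mulζ v) +ζ (cs ⊛ mulζ v))
    ≡⟨ +ζ-interchange _ _ _ _ ⟩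
  (scaleζ a v +ζ (as ⊛ mulζ v)) +ζ (scaleζ c v +ζ (cs ⊛ mulζ v))
    ∎
  where open ≡-Reasoning

*ζ-additiveʳ : ∀ a → Additive (a *ζ_)
*ζ-additiveʳ a@(_ ∷ _ ∷ _ ∷ _ ∷ _ ∷ _ ∷ _ ∷ _ ∷ []) = ⊛-additiveʳ a

*ζ-additiveˡ : ∀ v → Additive (_*ζ v)
*ζ-additiveˡ v a@(_ ∷ _ ∷ _ ∷ _ ∷ _ ∷ _ ∷ _ ∷ _ ∷ []) c@(_ ∷ _ ∷ _ ∷ _ ∷ _ ∷ _ ∷ _ ∷ _ ∷ []) =
  ⊛-distribʳ a c v

⊛-zerosˡ : ∀ k v → replicate k (+ 0) ⊛ v ≡ 0ζ
⊛-zerosˡ zero v = refl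
⊛-zerosˡ (suc k) v = cong₂ _+ζ_ (scaleζ-zeroˡ v) (⊛-zerosˡ k (mulζ v))

⊛-monomial : ∀ {k} j c v → (replicate j (+ 0) ++ c ∷ replicate k (+ 0)) ⊛ v ≡ scaleζ c (ζ^[ j ] v)
⊛-monomial {k} zero c v = trans (cong (scaleζ c v +ζ_) (⊛-zerosˡ k (mulζ v))) (+ζ-identityʳ _)
⊛-monomial {k} (suc j) c v = begin
  scaleζ (+ 0) v +ζ ((replicate j (+ 0) ++ c ∷ replicate k (+ 0)) ⊛ mulζ v)
                                       ≡⟨ cong₂ _+ζ_ (scaleζ-zeroˡ v) (⊛-monomial j c (mulζ v)) ⟩
  0ζ +ζ scaleζ c (ζ^[ j ] (mulζ v))    ≡⟨ +ζ-identityˡ _ ⟩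
  scaleζ c (ζ^[ j ] (mulζ v))          ≡⟨ cong (scaleζ c) (ζ^[]-mulζ j v) ⟩
  scaleζ c (ζ^[ suc j ] v)             ∎
  where open ≡-Reasoning

-- ζ ^ phase b is ζ for b = false and ζ⁻¹ = ζ¹⁵ for b = true.
phase : Bool → ℕ
phase false = 1
phase true = 15

twoCos±twoISin : ∀ b v → (twoCos *ζ v) +ζ (twoISin *ζ negateIf b v) ≡ scaleζ (+ 2) (ζ^[ phase b ] v)
twoCos±twoISin false v = trans (sym (*ζ-additiveˡ v twoCos twoISin)) (⊛-monomial {6} 1 (+ 2) v)
twoCos±twoISin true v = begin
  (twoCos *ζ v) +ζ (twoISin *ζ negζ v)    ≡⟨ cong ((twoCos *ζ v) +ζ_) (Additive⇒negζ (*ζ-additiveʳ twoISin) v) ⟩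
  (twoCos *ζ v) +ζ negζ (twoISin *ζ v)    ≡⟨ cong ((twoCos *ζ v) +ζ_) (Additive⇒negζ (*ζ-additiveˡ v) twoISin) ⟨
  (twoCos *ζ v) +ζ (negζ twoISin *ζ v)    ≡⟨ *ζ-additiveˡ v twoCos (negζ twoISin) ⟨
  (twoCos +ζ negζ twoISin) *ζ v           ≡⟨ ⊛-monomial {0} 7 (- + 2) v ⟩
  scaleζ (- + 2) (ζ^[ 7 ] v)              ≡⟨ scaleζ-neg (+ 2) _ ⟩
  negζ (scaleζ (+ 2) (ζ^[ 7 ] v))         ≡⟨ Additive⇒negζ (scaleζ-additive (+ 2)) _ ⟨
  scaleζ (+ 2) (negζ (ζ^[ 7 ] v))         ≡⟨ cong (scaleζ (+ 2)) (ζ^[8]≡negζ _) ⟨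
  scaleζ (+ 2) (ζ^[ 15 ] v)               ∎
  where open ≡-Reasoning

-- The Walsh–Hadamard transform

-- W ψ y = ∑ₓ (−1)^(x·y) ψ x
W : ∀ {n} → State n → 𝔽₂^ n → Zζ
W {zero} ψ [] = ψ []
W {suc n} ψ (b ∷ y) = W (ψ ∘ (false ∷_)) y +ζ negateIf b (W (ψ ∘ (true ∷_)) y)

W-cong : ∀ {n} {ψ φ : State n} → (∀ x → ψ x ≡ φ x) → ∀ y → W ψ y ≡ W φ y
W-cong {zero} ψ≗φ [] = ψ≗φ []
W-cong {suc n} ψ≗φ (b ∷ y) =
  cong₂ (λ u v → u +ζ negateIf b v) (W-cong (ψ≗φ ∘ (false ∷_)) y) (W-cong (ψ≗φ ∘ (true ∷_)) y)

W-+ : ∀ {n} (ψ φ : State n) y → W (λ x → ψ x +ζ φ x) y ≡ W ψ y +ζ W φ y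
W-+ {zero} ψ φ [] = refl
W-+ {suc n} ψ φ (b ∷ y) = begin
  W (λ x → ψ (false ∷ x) +ζ φ (false ∷ x)) y +ζ negateIf b (W (λ x → ψ (true ∷ x) +ζ φ (true ∷ x)) y)
    ≡⟨ cong₂ (λ u v → u +ζ negateIf b v) (W-+ _ _ y) (W-+ _ _ y) ⟩
  (W ψ₀ y +ζ W φ₀ y) +ζ negateIf b (W ψ₁ y +ζ W φ₁ y)
    ≡⟨ cong ((W ψ₀ y +ζ W φ₀ y) +ζ_) (negateIf-additive b _ _) ⟩
  (W ψ₀ y +ζ W φ₀ y) +ζ (negateIf b (W ψ₁ y) +ζ negateIf b (W φ₁ y))
    ≡⟨ +ζ-interchange _ _ _ _ ⟩
  (W ψ₀ y +ζ negateIf b (W ψ₁ y)) +ζ (W φ₀ y +ζ negateIf b (W φ₁ y))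
    ∎
  where
  open ≡-Reasoning
  ψ₀ ψ₁ φ₀ φ₁ : State n
  ψ₀ = ψ ∘ (false ∷_)
  ψ₁ = ψ ∘ (true ∷_)
  φ₀ = φ ∘ (false ∷_)
  φ₁ = φ ∘ (true ∷_)

W-additive : ∀ {f} → Additive f → ∀ {n} (ψ : State n) y → W (f ∘ ψ) y ≡ f (W ψ y)
W-additive f-additive {zero} ψ [] = refl
W-additive {f} f-additive {suc n} ψ (b ∷ y) = begin
  W (f ∘ ψ ∘ (false ∷_)) y +ζ negateIf b (W (f ∘ ψ ∘ (true ∷_)) y)
    ≡⟨ cong₂ (λ u v → u +ζ negateIf b v) (W-additive f-additive _ y) (W-additive f-additive _ y) ⟩
  f (W (ψ ∘ (false ∷_)) y) +ζ negateIf b (f (W (ψ ∘ (true ∷_)) y))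
    ≡⟨ cong (f (W (ψ ∘ (false ∷_)) y) +ζ_) (Additive⇒negateIf f-additive b _) ⟨
  f (W (ψ ∘ (false ∷_)) y) +ζ f (negateIf b (W (ψ ∘ (true ∷_)) y))
    ≡⟨ f-additive _ _ ⟨
  f (W ψ (b ∷ y))
    ∎
  where open ≡-Reasoning

negateIf-swap : ∀ b c u v → negateIf c v +ζ negateIf b (negateIf c u) ≡ negateIf (b xor c) (u +ζ negateIf b v)
negateIf-swap false c u v = trans (+ζ-comm _ _) (sym (negateIf-additive c u v))
negateIf-swap true false u v = sym (⁻¹-anti-homo‿- u v)
negateIf-swap true true u v = trans (cong (negζ v +ζ_) (⁻¹-involutive u)) (+ζ-comm _ _)

W-translate : ∀ {n} (ψ : State n) p y → W (λ x → ψ (x ⊕ p)) y ≡ negateIf (p · y) (W ψ y)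
W-translate {zero} ψ [] [] = refl
W-translate {suc n} ψ (false ∷ p) (b ∷ y) = begin
  W (λ x → ψ (false ∷ (x ⊕ p))) y +ζ negateIf b (W (λ x → ψ (true ∷ (x ⊕ p))) y)
    ≡⟨ cong₂ (λ u v → u +ζ negateIf b v) (W-translate _ p y) (W-translate _ p y) ⟩
  negateIf (p · y) (W (ψ ∘ (false ∷_)) y) +ζ negateIf b (negateIf (p · y) (W (ψ ∘ (true ∷_)) y))
    ≡⟨ cong (_ +ζ_) (Additive⇒negateIf (negateIf-additive b) (p · y) _) ⟩
  negateIf (p · y) (W (ψ ∘ (false ∷_)) y) +ζ negateIf (p · y) (negateIf b (W (ψ ∘ (true ∷_)) y))
    ≡⟨ negateIf-additive (p · y) _ _ ⟨
  negateIf (p · y) (W ψ (b ∷ y))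
    ∎
  where open ≡-Reasoning
W-translate {suc n} ψ (true ∷ p) (b ∷ y) =
  trans (cong₂ (λ u v → u +ζ negateIf b v) (W-translate _ p y) (W-translate _ p y))
        (negateIf-swap b (p · y) _ _)

W-modulate : ∀ {n} (ψ : State n) s y → W (λ x → negateIf (x · s) (ψ x)) y ≡ W ψ (y ⊕ s)
W-modulate {zero} ψ [] [] = refl
W-modulate {suc n} ψ (a ∷ s) (b ∷ y) = begin
  W (λ x → negateIf (x · s) (ψ₀ x)) y +ζ negateIf b (W (λ x → negateIf (a xor (x · s)) (ψ₁ x)) y)
    ≡⟨ cong₂ (λ u v → u +ζ negateIf b v) (W-modulate ψ₀ s y) modulate₁ ⟩
  W ψ₀ (y ⊕ s) +ζ negateIf b (negateIf a (W ψ₁ (y ⊕ s)))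
    ≡⟨ cong (W ψ₀ (y ⊕ s) +ζ_) (negateIf-xor b a _) ⟨
  W ψ₀ (y ⊕ s) +ζ negateIf (b xor a) (W ψ₁ (y ⊕ s))
    ∎
  where
  open ≡-Reasoning
  ψ₀ ψ₁ : State n
  ψ₀ = ψ ∘ (false ∷_)
  ψ₁ = ψ ∘ (true ∷_)
  modulate₁ : W (λ x → negateIf (a xor (x · s)) (ψ₁ x)) y ≡ negateIf a (W ψ₁ (y ⊕ s))
  modulate₁ = begin
    W (λ x → negateIf (a xor (x · s)) (ψ₁ x)) y    ≡⟨ W-cong (λ x → negateIf-xor a (x · s) _) y ⟩
    W (negateIf a ∘ λ x → negateIf (x · s) (ψ₁ x)) y ≡⟨ W-additive (negateIf-additive a) _ y ⟩
    negateIf a (W (λ x → negateIf (x · s) (ψ₁ x)) y) ≡⟨ cong (negateIf a) (W-modulate ψ₁ s y) ⟩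
    negateIf a (W ψ₁ (y ⊕ s))                       ∎

W-zero : ∀ {n} y → W {n} (λ _ → 0ζ) y ≡ 0ζ
W-zero = W-additive {λ _ → 0ζ} (λ _ _ → refl) ket0

W-ket0 : ∀ {n} y → W {n} ket0 y ≡ 1ζ
W-ket0 {zero} [] = refl
W-ket0 {suc n} (b ∷ y) =
  trans (cong₂ (λ u v → u +ζ negateIf b v) (W-ket0 y) (W-zero y))
        (cong (1ζ +ζ_) (Additive⇒0 (negateIf-additive b)))

W-gate2 : ∀ {n} p (ψ : State n) y →
          W (gate2 p ψ) y ≡ (twoCos *ζ W ψ y) +ζ (twoISin *ζ negateIf (p · y) (W ψ y))
W-gate2 p ψ y =
  trans (W-+ _ _ y)
        (cong₂ _+ζ_ (W-additive (*ζ-additiveʳ twoCos) ψ y)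
                    (trans (W-additive (*ζ-additiveʳ twoISin) _ y) (cong (twoISin *ζ_) (W-translate ψ p y))))

phaseSum : ∀ {n} → List (𝔽₂^ n) → 𝔽₂^ n → ℕ
phaseSum P y = sum (L.map (λ p → phase (p · y)) P)

W-ampl2 : ∀ {n} (P : List (𝔽₂^ n)) y →
          W (ampl2 P) y ≡ scaleζ (+ (2 ^ L.length P)) (ζ^[ phaseSum P y ] 1ζ)
W-ampl2 [] y = W-ket0 y
W-ampl2 (p ∷ P) y = begin
  W (gate2 p (ampl2 P)) y
    ≡⟨ W-gate2 p (ampl2 P) y ⟩
  (twoCos *ζ W (ampl2 P) y) +ζ (twoISin *ζ negateIf (p · y) (W (ampl2 P) y))
    ≡⟨ cong (λ w → (twoCos *ζ w) +ζ (twoISin *ζ negateIf (p · y) w)) (W-ampl2 P y) ⟩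
  (twoCos *ζ scaleζ c z) +ζ (twoISin *ζ negateIf (p · y) (scaleζ c z))
    ≡⟨ twoCos±twoISin (p · y) _ ⟩
  scaleζ (+ 2) (ζ^[ phase (p · y) ] (scaleζ c z))
    ≡⟨ cong (scaleζ (+ 2)) (ζ^[]-scaleζ (phase (p · y)) c z) ⟩
  scaleζ (+ 2) (scaleζ c (ζ^[ phase (p · y) ] z))
    ≡⟨ scaleζ-assoc (+ 2) c _ ⟩
  scaleζ (+ 2 *ℤ c) (ζ^[ phase (p · y) ] z)
    ≡⟨ cong₂ scaleζ (sym (ℤ.pos-* 2 (2 ^ L.length P))) (ζ^[]-+ (phase (p · y)) (phaseSum P y) 1ζ) ⟩
  scaleζ (+ (2 ^ L.length (p ∷ P))) (ζ^[ phaseSum (p ∷ P) y ] 1ζ)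
    ∎
  where
  open ≡-Reasoning
  c = + (2 ^ L.length P)
  z = ζ^[ phaseSum P y ] 1ζ

W-ampl2-periodic : ∀ {n} (P : List (𝔽₂^ n)) s → ProbXsZeroIsOne P s →
                   ∀ y → W (ampl2 P) (y ⊕ s) ≡ W (ampl2 P) y
W-ampl2-periodic P s amplitude-zero y = trans (sym (W-modulate (ampl2 P) s y)) (W-cong unchanged y)
  where
  unchanged : ∀ x → negateIf (x · s) (ampl2 P x) ≡ ampl2 P x
  unchanged x with x · s in x·s≡true
  ... | false = refl
  ... | true = trans (cong negζ (amplitude-zero x x·s≡true)) (sym (amplitude-zero x x·s≡true))

-- Exponents of ζ modulo 16

ζ^[*16]≡id : ∀ q v → ζ^[ q * 16 ] v ≡ v
ζ^[*16]≡id zero v = refl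
ζ^[*16]≡id (suc q) v =
  trans (sym (ζ^[]-+ 16 (q * 16) v)) (trans (ζ^[16]≡id _) (ζ^[*16]≡id q v))

ζ^[]-mod16 : ∀ a v → ζ^[ a ] v ≡ ζ^[ a % 16 ] v
ζ^[]-mod16 a v = begin
  ζ^[ a ] v                          ≡⟨ cong (λ k → ζ^[ k ] v) (trans (m≡m%n+[m/n]*n a 16) (ℕ.+-comm (a % 16) _)) ⟩
  ζ^[ a / 16 * 16 + a % 16 ] v       ≡⟨ ζ^[]-+ (a / 16 * 16) (a % 16) v ⟨
  ζ^[ a / 16 * 16 ] (ζ^[ a % 16 ] v) ≡⟨ ζ^[*16]≡id (a / 16) _ ⟩
  ζ^[ a % 16 ] v                     ∎
  where open ≡-Reasoning

ζ-log : Zζ → ℕ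
ζ-log v = search 16
  where
  search : ℕ → ℕ
  search zero = 0
  search (suc i) = if does (≡-dec ℤ._≟_ v (ζ^[ i ] 1ζ)) then i else search i

ζ-log-ζ^ : ∀ {r} → r < 16 → ζ-log (ζ^[ r ] 1ζ) ≡ r
ζ-log-ζ^ = toWitness {a? = allUpTo? (λ r → ζ-log (ζ^[ r ] 1ζ) ℕ.≟ r) 16} _

ζ^-injective-mod16 : ∀ a b → ζ^[ a ] 1ζ ≡ ζ^[ b ] 1ζ → a % 16 ≡ b % 16
ζ^-injective-mod16 a b eq = begin
  a % 16                  ≡⟨ ζ-log-ζ^ (m%n<n a 16) ⟨
  ζ-log (ζ^[ a % 16 ] 1ζ) ≡⟨ cong ζ-log (trans (sym (ζ^[]-mod16 a 1ζ)) (trans eq (ζ^[]-mod16 b 1ζ))) ⟩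
  ζ-log (ζ^[ b % 16 ] 1ζ) ≡⟨ ζ-log-ζ^ (m%n<n b 16) ⟩
  b % 16                  ∎
  where open ≡-Reasoning

%-≡⇒∣- : ∀ m .{{_ : NonZero m}} a b → a % m ≡ b % m → + m ∣ + a -ℤ + b
%-≡⇒∣- m a b a%m≡b%m = divides (+ (a / m) -ℤ + (b / m)) (begin
  + a -ℤ + b                                ≡⟨ cong₂ _-ℤ_ (+-divMod a) (+-divMod b) ⟩
  (+ (a % m) +ℤ qa) -ℤ (+ (b % m) +ℤ qb)    ≡⟨ cong (λ r → (+ (a % m) +ℤ qa) -ℤ (+ r +ℤ qb)) a%m≡b%m ⟨
  (+ (a % m) +ℤ qa) -ℤ (+ (a % m) +ℤ qb)    ≡⟨ cancel (+ (a % m)) (+ (a / m)) (+ (b / m)) (+ m) ⟩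
  (+ (a / m) -ℤ + (b / m)) *ℤ + m           ∎)
  where
  open ≡-Reasoning
  qa = + (a / m) *ℤ + m
  qb = + (b / m) *ℤ + m
  +-divMod : ∀ k → + k ≡ + (k % m) +ℤ + (k / m) *ℤ + m
  +-divMod k = trans (cong +_ (m≡m%n+[m/n]*n k m)) (trans (ℤ.pos-+ (k % m) _) (cong (+ (k % m) +ℤ_) (ℤ.pos-* (k / m) m)))
  cancel : ∀ r x y z → (r +ℤ x *ℤ z) -ℤ (r +ℤ y *ℤ z) ≡ (x -ℤ y) *ℤ z
  cancel = solve-∀

-- Sums over the rows of P

𝟙 : Bool → ℤ
𝟙 false = + 0
𝟙 true = + 1

χ : Bool → ℤ
χ false = + 1
χ true = - + 1

∑ : {A : Set} → List A → (A → ℤ) → ℤ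
∑ xs f = L.foldr (λ x s → f x +ℤ s) (+ 0) xs

module _ {A : Set} where

  ∑-cong : ∀ (xs : List A) {f g : A → ℤ} → (∀ x → f x ≡ g x) → ∑ xs f ≡ ∑ xs g
  ∑-cong [] f≗g = refl
  ∑-cong (x ∷ xs) f≗g = cong₂ _+ℤ_ (f≗g x) (∑-cong xs f≗g)

  ∑-+ : ∀ (xs : List A) f g → ∑ xs (λ x → f x +ℤ g x) ≡ ∑ xs f +ℤ ∑ xs g
  ∑-+ [] f g = refl
  ∑-+ (x ∷ xs) f g = trans (cong ((f x +ℤ g x) +ℤ_) (∑-+ xs f g)) (+ℤ-interchange (f x) (g x) (∑ xs f) (∑ xs g))

  ∑-*ˡ : ∀ (xs : List A) c f → ∑ xs (λ x → c *ℤ f x) ≡ c *ℤ ∑ xs f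
  ∑-*ˡ [] c f = sym (ℤ.*-zeroʳ c)
  ∑-*ˡ (x ∷ xs) c f = trans (cong (c *ℤ f x +ℤ_) (∑-*ˡ xs c f)) (sym (ℤ.*-distribˡ-+ c (f x) _))

  pos-sum : ∀ (f : A → ℕ) xs → + sum (L.map f xs) ≡ ∑ xs (λ x → + f x)
  pos-sum f [] = refl
  pos-sum f (x ∷ xs) = trans (ℤ.pos-+ (f x) _) (cong (+ f x +ℤ_) (pos-sum f xs))

signedCount : ∀ {n} → 𝔽₂^ n → List (𝔽₂^ n) → 𝔽₂^ n → ℤ
signedCount s P y = ∑ P (λ p → 𝟙 (p · s) *ℤ χ (p · y))

phase-xor : ∀ a b → + phase (a xor b) ≡ + phase a +ℤ + 14 *ℤ (𝟙 b *ℤ χ a)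
phase-xor false false = refl
phase-xor false true = refl
phase-xor true false = refl
phase-xor true true = refl

phaseSum-shift : ∀ {n} s (P : List (𝔽₂^ n)) y →
                 + phaseSum P (y ⊕ s) ≡ + phaseSum P y +ℤ + 14 *ℤ signedCount s P y
phaseSum-shift s P y = begin
  + phaseSum P (y ⊕ s)
    ≡⟨ pos-sum (λ p → phase (p · (y ⊕ s))) P ⟩
  ∑ P (λ p → + phase (p · (y ⊕ s)))
    ≡⟨ ∑-cong P (λ p → trans (cong (+_ ∘ phase) (·-distribˡ-⊕ p y s)) (phase-xor (p · y) (p · s))) ⟩
  ∑ P (λ p → + phase (p · y) +ℤ + 14 *ℤ (𝟙 (p · s) *ℤ χ (p · y)))
    ≡⟨ ∑-+ P (λ p → + phase (p · y)) (λ p → + 14 *ℤ (𝟙 (p · s) *ℤ χ (p · y))) ⟩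
  ∑ P (λ p → + phase (p · y)) +ℤ ∑ P (λ p → + 14 *ℤ (𝟙 (p · s) *ℤ χ (p · y)))
    ≡⟨ cong₂ _+ℤ_ (sym (pos-sum (λ p → phase (p · y)) P)) (∑-*ˡ P (+ 14) (λ p → 𝟙 (p · s) *ℤ χ (p · y))) ⟩
  + phaseSum P y +ℤ + 14 *ℤ signedCount s P y
    ∎
  where open ≡-Reasoning

16∣14x⇒8∣x : ∀ x → + 16 ∣ + 14 *ℤ x → + 8 ∣ x
16∣14x⇒8∣x x 16∣14x = subst (+ 8 ∣_) (8x-7x≡x x) (∣m∣n⇒∣m-n (∣m⇒∣m*n x ∣-refl) 8∣7x)
  where
  8∣7x : + 8 ∣ + 7 *ℤ x
  8∣7x = *-cancelˡ-∣ (+ 2) (subst (+ 16 ∣_) (ℤ.*-assoc (+ 2) (+ 7) x) 16∣14x)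
  8x-7x≡x : ∀ x → + 8 *ℤ x -ℤ + 7 *ℤ x ≡ x
  8x-7x≡x = solve-∀

8∣signedCount : ∀ {n} (P : List (𝔽₂^ n)) s → ProbXsZeroIsOne P s → ∀ y → + 8 ∣ signedCount s P y
8∣signedCount P s amplitude-zero y =
  16∣14x⇒8∣x (signedCount s P y) (subst (+ 16 ∣_) phase-difference (%-≡⇒∣- 16 E₁ E₀ phases-agree-mod16))
  where
  E₁ E₀ : ℕ
  E₁ = phaseSum P (y ⊕ s)
  E₀ = phaseSum P y
  instance
    2^|P|≢0 : NonZero (2 ^ L.length P)
    2^|P|≢0 = ℕ.m^n≢0 2 (L.length P)
  phases-agree-mod16 : E₁ % 16 ≡ E₀ % 16
  phases-agree-mod16 = ζ^-injective-mod16 E₁ E₀ (scaleζ-injective (2 ^ L.length P) _ _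
    (trans (sym (W-ampl2 P (y ⊕ s))) (trans (W-ampl2-periodic P s amplitude-zero y) (W-ampl2 P y))))
  phase-difference : + E₁ -ℤ + E₀ ≡ + 14 *ℤ signedCount s P y
  phase-difference = trans (cong (_-ℤ + E₀) (phaseSum-shift s P y)) (xyx⁻¹≈y (+ E₀) _)

χ-parallelogram : ∀ a c b →
  𝟙 b *ℤ χ false +ℤ 𝟙 b *ℤ χ (a xor c) ≡ (𝟙 b *ℤ χ a +ℤ 𝟙 b *ℤ χ c) +ℤ + 4 *ℤ 𝟙 ((a ∧ c) ∧ b)
χ-parallelogram false false false = refl
χ-parallelogram false false true = refl
χ-parallelogram false true false = refl
χ-parallelogram false true true = refl
χ-parallelogram true false false = refl
χ-parallelogram true false true = refl
χ-parallelogram true true false = refl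
χ-parallelogram true true true = refl

signedCount-parallelogram : ∀ {n} s (P : List (𝔽₂^ n)) d e →
  signedCount s P 𝟎 +ℤ signedCount s P (d ⊕ e) ≡
  (signedCount s P d +ℤ signedCount s P e) +ℤ + 4 *ℤ ∑ P (λ p → 𝟙 ((p · d ∧ p · e) ∧ p · s))
signedCount-parallelogram s P d e = begin
  ∑ P (term 𝟎) +ℤ ∑ P (term (d ⊕ e))
    ≡⟨ ∑-+ P (term 𝟎) (term (d ⊕ e)) ⟨
  ∑ P (λ p → term 𝟎 p +ℤ term (d ⊕ e) p)
    ≡⟨ ∑-cong P row ⟩
  ∑ P (λ p → (term d p +ℤ term e p) +ℤ + 4 *ℤ triple p)
    ≡⟨ ∑-+ P (λ p → term d p +ℤ term e p) (λ p → + 4 *ℤ triple p) ⟩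
  ∑ P (λ p → term d p +ℤ term e p) +ℤ ∑ P (λ p → + 4 *ℤ triple p)
    ≡⟨ cong₂ _+ℤ_ (∑-+ P (term d) (term e)) (∑-*ˡ P (+ 4) triple) ⟩
  (∑ P (term d) +ℤ ∑ P (term e)) +ℤ + 4 *ℤ ∑ P triple
    ∎
  where
  open ≡-Reasoning
  term : _ → _ → ℤ
  term y p = 𝟙 (p · s) *ℤ χ (p · y)
  triple : _ → ℤ
  triple p = 𝟙 ((p · d ∧ p · e) ∧ p · s)
  row : ∀ p → term 𝟎 p +ℤ term (d ⊕ e) p ≡ (term d p +ℤ term e p) +ℤ + 4 *ℤ triple p
  row p = trans (cong₂ (λ u v → 𝟙 (p · s) *ℤ χ u +ℤ 𝟙 (p · s) *ℤ χ v) (·-zeroʳ p) (·-distribˡ-⊕ p d e))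
                (χ-parallelogram (p · d) (p · e) (p · s))

even-tripleCount : ∀ {n} (P : List (𝔽₂^ n)) s → ProbXsZeroIsOne P s →
                   ∀ d e → + 2 ∣ ∑ P (λ p → 𝟙 ((p · d ∧ p · e) ∧ p · s))
even-tripleCount P s amplitude-zero d e =
  *-cancelˡ-∣ (+ 4)
    (∣m+n∣m⇒∣n (subst (+ 8 ∣_) (signedCount-parallelogram s P d e) (∣m∣n⇒∣m+n (8∣ 𝟎) (8∣ (d ⊕ e))))
               (∣m∣n⇒∣m+n (8∣ d) (8∣ e)))
  where
  8∣ : ∀ y → + 8 ∣ signedCount s P y
  8∣ = 8∣signedCount P s amplitude-zero

-- Parity

2∤1 : ¬ (+ 2 ∣ + 1)
2∤1 2∣1 with () ← ∣1⇒≡1 (∣⇒∣ᵤ 2∣1)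

⨁ : {A : Set} → List A → (A → Bool) → Bool
⨁ xs f = L.foldr (λ x b → f x xor b) false xs

𝟙-xor : ∀ b c S → (𝟙 b +ℤ S) -ℤ 𝟙 (b xor c) ≡ (S -ℤ 𝟙 c) +ℤ + 2 *ℤ 𝟙 (b ∧ c)
𝟙-xor false false = solve-∀
𝟙-xor false true = solve-∀
𝟙-xor true false = solve-∀
𝟙-xor true true = solve-∀

module _ {A : Set} where

  ∑𝟙≡⨁-mod2 : ∀ (xs : List A) f → + 2 ∣ ∑ xs (𝟙 ∘ f) -ℤ 𝟙 (⨁ xs f)
  ∑𝟙≡⨁-mod2 [] f = divides (+ 0) refl
  ∑𝟙≡⨁-mod2 (x ∷ xs) f =
    subst (+ 2 ∣_) (sym (𝟙-xor (f x) (⨁ xs f) (∑ xs (𝟙 ∘ f))))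
          (∣m∣n⇒∣m+n (∑𝟙≡⨁-mod2 xs f) (∣m⇒∣m*n (𝟙 (f x ∧ ⨁ xs f)) ∣-refl))

  even-∑𝟙⇒⨁≡false : ∀ (xs : List A) f → + 2 ∣ ∑ xs (𝟙 ∘ f) → ⨁ xs f ≡ false
  even-∑𝟙⇒⨁≡false xs f 2∣∑ with ⨁ xs f | ∑𝟙≡⨁-mod2 xs f
  ... | false | _ = refl
  ... | true | 2∣∑-1 = contradiction (subst (+ 2 ∣_) (S-[S-1]≡1 (∑ xs (𝟙 ∘ f))) (∣m∣n⇒∣m-n 2∣∑ 2∣∑-1)) 2∤1
    where
    S-[S-1]≡1 : ∀ S → S -ℤ (S -ℤ + 1) ≡ + 1
    S-[S-1]≡1 = solve-∀

  ⨁-filter : ∀ (g : A → Bool) xs f → ⨁ (L.filter (λ x → g x Bool.≟ true) xs) f ≡ ⨁ xs (λ x → g x ∧ f x)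
  ⨁-filter g [] f = refl
  ⨁-filter g (x ∷ xs) f with g x
  ... | true = cong (f x xor_) (⨁-filter g xs f)
  ... | false = ⨁-filter g xs f

vsum-· : ∀ {n} (xs : List (𝔽₂^ n)) s → vsum xs · s ≡ ⨁ xs (_· s)
vsum-· [] s = ·-zeroˡ s
vsum-· (x ∷ xs) s = trans (·-distribʳ-⊕ x (vsum xs) s) (cong ((x · s) xor_) (vsum-· xs s))

mainTheorem16 : (n : ℕ) (P : List (𝔽₂^ n)) (s : 𝔽₂^ n) →
    ProbXsZeroIsOne P s → ProbYsZeroIsOne P s
mainTheorem16 n P s amplitude-zero d e = begin
  vsum (Pde P d e) · s                ≡⟨ vsum-· (Pde P d e) s ⟩
  ⨁ (Pde P d e) (_· s)                ≡⟨ ⨁-filter (λ p → p · d ∧ p · e) P (_· s) ⟩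
  ⨁ P (λ p → (p · d ∧ p · e) ∧ p · s) ≡⟨ even-∑𝟙⇒⨁≡false P (λ p → (p · d ∧ p · e) ∧ p · s) (even-tripleCount P s amplitude-zero d e) ⟩
  false                               ∎
  where open ≡-Reasoning
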